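{- Let $R(\mathbf{x},\mathbf{x}')$ be a balanced difference bounds constraint over $N$ variables, let $n\ge1$, and let $\theta$ be a short corner in $\mathcal{G}_R^n$ from $x_i^{(k)}$ to $x_j^{(k)}$. Then, writing $w(\theta)$ for its weight: if $\theta$ is a right corner, $R_s(\mathbf{x},\mathbf{x}')\Rightarrow S_{fw}(\mathbf{x})\Rightarrow x_i-x_j\le w(\theta)$; if $\theta$ is a left corner, $R_s(\mathbf{x},\mathbf{x}')\Rightarrow S_{bw}(\mathbf{x}')\Rightarrow x_i'-x_j'\le w(\theta)$. Consequently, $\mathcal{G}_{R_s}^n$ contains a vertical edge $x_i^{(k)}\xrightarrow{c}x_j^{(k)}$ for some $c\le w(\theta)$.
   Context: Variables range over $\mathbb{Z}$; $\mathbf{x}=\{x_1,\dots,x_N\}$, $\mathbf{x}'$ its primed copy. A difference bounds (DB) constraint is a finite conjunction of atoms $u-v\le c$, $c\in\mathbb{Z}$; its constraint graph has an edge $u\xrightarrow{c}v$ per atom. $R$ is balanced if $x_i-x_j\le c$ is an atom of $R$ iff $x_i'-x_j'\le c$ is. $R^n$ is the $n$-fold composition. $S_{fw}(\mathbf{x}):=\exists\mathbf{x}'.R^{N^2}(\mathbf{x},\mathbf{x}')$, $S_{bw}(\mathbf{x}'):=\exists\mathbf{x}.R^{N^2}(\mathbf{x},\mathbf{x}')$, $R_s:=R\wedge S_{fw}(\mathbf{x})\wedge S_{bw}(\mathbf{x}')$, regarded as a DB constraint (existential quantification of a DB constraint yields an equivalent DB constraint). With fresh copies $x_i^{(p)}$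 (position $p$), $\mathcal{G}_R^n$ is the union over $p=0,\dots,n-1$ of the constraint graphs of $R(\mathbf{x}^{(p)},\mathbf{x}^{(p+1)})$. An edge is vertical if its endpoints have the same position. A corner is a path with at least one edge whose endpoints have the same position $k_0$; it is a right (left) corner of extent $d$ if its positions are $\{k_0,\dots,k_0+d\}$ ($\{k_0-d,\dots,k_0\}$); it is short if $d\le N^2$. -}

module Defs where

open import Data.Nat using (ℕ; zero; suc; _<_; _^_) renaming (_≤_ to _≤ℕ_; _+_ to _+ℕ_)
open import Data.Integer using (ℤ; _-_; _+_; _≤_; 0ℤ)
open import Data.Fin using (Fin)
open import Data.Sum using (_⊎_; inj₁; inj₂)
open import Data.Product using (Σ; Σ-syntax; ∃; ∃-syntax; _×_; _,_; proj₁)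
open import Data.List using (List; []; _∷_; _++_)
open import Data.List.Membership.Propositional using (_∈_)
open import Data.List.Relation.Unary.All using (All)
open import Data.List.Relation.Unary.Any using (Any)
open import Relation.Binary.PropositionalEquality using (_≡_)

-- A variable of R(x, x') : inj₁ i is x_i (unprimed), inj₂ i is x_i' (primed).
Var : ℕ → Set
Var N = Fin N ⊎ Fin N

record Atom (N : ℕ) : Set where
  constructor atom
  field
    lhs   : Var N
    rhs   : Var N
    bound : ℤ
open Atom public

DB : ℕ → Set
DB N = List (Atom N)

Val : ℕ → Set
Val N = Fin N → ℤ

⟦_⟧ : ∀ {N} → Var N → Val N → Val N → ℤ
⟦ inj₁ i ⟧ ν ν' = ν i
⟦ inj₂ i ⟧ ν ν' = ν' i

SatAtom : ∀ {N} → Val N → Val N → Atom N → Set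
SatAtom ν ν' a = ⟦ lhs a ⟧ ν ν' - ⟦ rhs a ⟧ ν ν' ≤ bound a

Sat : ∀ {N} → DB N → Val N → Val N → Set
Sat R ν ν' = All (SatAtom ν ν') R

Balanced : ∀ {N} → DB N → Set
Balanced {N} R = ∀ (i j : Fin N) (c : ℤ) →
  (atom (inj₁ i) (inj₁ j) c ∈ R → atom (inj₂ i) (inj₂ j) c ∈ R) ×
  (atom (inj₂ i) (inj₂ j) c ∈ R → atom (inj₁ i) (inj₁ j) c ∈ R)

Pow : ∀ {N} → DB N → ℕ → Val N → Val N → Set
Pow R zero    ν ν'' = ∀ i → ν i ≡ ν'' i
Pow R (suc n) ν ν'' = ∃[ ν' ] (Sat R ν ν' × Pow R n ν' ν'')

Sfw : ∀ {N} → DB N → Val N → Set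
Sfw {N} R ν = ∃[ ν' ] Pow R (N ^ 2) ν ν'

Sbw : ∀ {N} → DB N → Val N → Set
Sbw {N} R ν' = ∃[ ν ] Pow R (N ^ 2) ν ν'

Rs : ∀ {N} → DB N → Val N → Val N → Set
Rs R ν ν' = Sat R ν ν' × Sfw R ν × Sbw R ν'

-- A DB constraint T is a DB representation of a unary predicate S on the
-- unprimed (side = inj₁) resp. primed (side = inj₂) copy if all its atoms
-- mention only that copy, it is equivalent to S, and it is closed
-- (canonical, as produced by quantifier elimination via shortest paths):
-- every implied bound between two variables of that copy is dominated by
-- an atom of T.

Side : ℕ → Set
Side N = (Fin N → Var N)

Unprimed : ∀ {N} → Side N
Unprimed = inj₁

Primed : ∀ {N} → Side N
Primed = inj₂

sel : ∀ {N} → Side N → Val N → Val N → Val N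
sel side ν ν' i = ⟦ side i ⟧ ν ν'

record DBRep {N : ℕ} (side : Side N) (S : Val N → Set) (T : DB N) : Set where
  field
    onSide : All (λ a → (∃[ i ] lhs a ≡ side i) × (∃[ j ] rhs a ≡ side j)) T
    sound  : ∀ ν ν' → Sat T ν ν' → S (sel side ν ν')
    complete : ∀ ν ν' → S (sel side ν ν') → Sat T ν ν'
    closed : ∀ (i j : Fin N) (c : ℤ) →
      (∀ ν ν' → Sat T ν ν' → ⟦ side i ⟧ ν ν' - ⟦ side j ⟧ ν ν' ≤ c) →
      ∃[ c' ] (c' ≤ c × atom (side i) (side j) c' ∈ T)

-- The graph G_R^n.  Nodes are x_i^{(p)} = (p , i).

Node : ℕ → Set
Node N = ℕ × Fin N

pos : ∀ {N} → Node N → ℕ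
pos = proj₁

-- variable of R(x^{(p)}, x^{(p+1)}) as a node
place : ∀ {N} → ℕ → Var N → Node N
place p (inj₁ i) = p , i
place p (inj₂ i) = suc p , i

Edge : ∀ {N} → DB N → ℕ → Node N → Node N → ℤ → Set
Edge {N} R n u v c = Σ[ p ∈ ℕ ] Σ[ a ∈ Atom N ]
  (p < n × a ∈ R × place p (lhs a) ≡ u × place p (rhs a) ≡ v × bound a ≡ c)

data Path {N : ℕ} (R : DB N) (n : ℕ) : Node N → Node N → Set where
  []  : ∀ {u} → Path R n u u
  _∷_ : ∀ {u v w c} → Edge R n u v c → Path R n v w → Path R n u w

weight : ∀ {N} {R : DB N} {n} {u v} → Path R n u v → ℤ
weight [] = 0ℤ
weight (_∷_ {c = c} e θ) = c + weight θ

edges : ∀ {N} {R : DB N} {n} {u v} → Path R n u v → ℕ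
edges [] = zero
edges (e ∷ θ) = suc (edges θ)

nodes : ∀ {N} {R : DB N} {n} {u v} → Path R n u v → List (Node N)
nodes ([] {u}) = u ∷ []
nodes (_∷_ {u = u} e θ) = u ∷ nodes θ

RightCorner : ∀ {N} {R : DB N} {n} (k : ℕ) {i j : Fin N} →
  Path R n (k , i) (k , j) → ℕ → Set
RightCorner k θ d =
  1 ≤ℕ edges θ ×
  All (λ x → k ≤ℕ pos x × pos x ≤ℕ k +ℕ d) (nodes θ) ×
  (∀ q → k ≤ℕ q → q ≤ℕ k +ℕ d → Any (λ x → pos x ≡ q) (nodes θ))

LeftCorner : ∀ {N} {R : DB N} {n} (k : ℕ) {i j : Fin N} →
  Path R n (k , i) (k , j) → ℕ → Set
LeftCorner k θ d =
  1 ≤ℕ edges θ × d ≤ℕ k ×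
  All (λ x → k ≤ℕ pos x +ℕ d × pos x ≤ℕ k) (nodes θ) ×
  (∀ q → k ≤ℕ q +ℕ d → q ≤ℕ k → Any (λ x → pos x ≡ q) (nodes θ))

module Submission where

-- A valuation ν with S_fw(ν) comes with an R-chain
-- ν = ν₀, ν₁, …, ν_M (M = N², consecutive pairs satisfy R).  Laying this
-- chain over the positions of G_R^n gives a potential on nodes; for a
-- balanced R every edge whose endpoints lie in the window of M+1 positions
-- covered by the chain is satisfied by the potential (at the two ends of the
-- window, balancedness turns a missing step of the chain into the other
-- copy of the same atom).  Telescoping along a path then bounds the
-- potential difference of its endpoints by the weight of the path.  A short
-- right corner at position k fits into the window starting at k (so the
-- bound is about ν₀ = ν), a short left corner into the window ending at k
-- (so it is about ν_M = ν').  Finally, a closed DB representation of S_fw or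
-- S_bw contains an atom dominating every implied bound; placed at position
-- k (or k-1 for the primed copy) it is the vertical edge of G_{R_s}^n.  The
-- border cases k = n (right corner) and k = 0 (left corner) are flat paths,
-- which fit into either window.

open import Defs
open import Data.Nat using (ℕ; _^_) renaming (_≤_ to _≤ℕ_)
open import Data.Integer using (ℤ; _-_; _≤_)
open import Data.Fin using (Fin)
open import Data.Sum using (_⊎_)
open import Data.Product using (_×_; _,_; ∃-syntax)
open import Data.List using (_++_)

open import Data.Nat using (zero; suc; z≤n; s≤s; _∸_; _<?_; _≟_; _≤?_)
  renaming (_<_ to _<ℕ_; _+_ to _+ℕ_)
import Data.Nat.Properties as ℕP
import Data.Integer.Properties as ℤP
open import Data.Sum using (inj₁; inj₂)
open import Data.Product using (proj₁; proj₂)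
open import Data.List.Relation.Unary.All as All using (All; []; _∷_)
open import Data.List.Membership.Propositional using (_∈_)
open import Data.List.Membership.Propositional.Properties using (∈-++⁺ˡ; ∈-++⁺ʳ)
open import Relation.Binary.PropositionalEquality
  using (_≡_; refl; sym; subst; subst₂)
open import Relation.Nullary using (yes; no)

source-of-nodes : ∀ {N} {R : DB N} {n u w} {P : Node N → Set}
  (θ : Path R n u w) → All P (nodes θ) → P u
source-of-nodes []      (pu ∷ _) = pu
source-of-nodes (_ ∷ _) (pu ∷ _) = pu

place-pos : ∀ {N} p (x : Var N) → pos (place p x) ≤ℕ suc p
place-pos p (inj₁ _) = ℕP.n≤1+n p
place-pos p (inj₂ _) = ℕP.≤-refl

edge-pos : ∀ {N} {R : DB N} {n u v c} → Edge R n u v c → pos u ≤ℕ n × pos v ≤ℕ n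
edge-pos (p , a , p<n , _ , refl , refl , _) =
  ℕP.≤-trans (place-pos p (lhs a)) p<n , ℕP.≤-trans (place-pos p (rhs a)) p<n

path-pos : ∀ {N} {R : DB N} {n u w} (θ : Path R n u w) → 1 ≤ℕ edges θ →
  All (λ x → pos x ≤ℕ n) (nodes θ)
path-pos (e ∷ [])        _ = proj₁ (edge-pos e) ∷ proj₂ (edge-pos e) ∷ []
path-pos (e ∷ θ@(_ ∷ _)) _ = proj₁ (edge-pos e) ∷ path-pos θ (s≤s z≤n)

path-potential : ∀ {N} {R : DB N} {n} (F : Node N → ℤ) (P : Node N → Set) →
  (∀ {u v c} → Edge R n u v c → P u → P v → F u - F v ≤ c) →
  ∀ {u w} (θ : Path R n u w) → All P (nodes θ) → F u - F w ≤ weight θ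
path-potential F P edge-ok {u} [] _ = ℤP.≤-reflexive (ℤP.+-inverseʳ (F u))
path-potential F P edge-ok {u} {w} (_∷_ {v = v} e θ) (pu ∷ ps) =
  subst (_≤ _) (ℤP.+-minus-telescope (F u) (F v) (F w))
    (ℤP.+-mono-≤ (edge-ok e pu (source-of-nodes θ ps)) (path-potential F P edge-ok θ ps))

module _ {N : ℕ} (R : DB N) where

  Chain : (ℕ → Val N) → ℕ → ℕ → Set
  Chain G a b = ∀ q → a ≤ℕ q → q <ℕ b → Sat R (G q) (G (suc q))

  -- The intermediate valuations ν = trace P 0, …, trace P m = ν'' of a
  -- witness P of R^m(ν, ν'').
  trace : ∀ {m ν ν''} → Pow R m ν ν'' → ℕ → Val N
  trace {ν = ν} _ zero = ν
  trace {zero} {ν} _ (suc t) = ν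
  trace {suc m} (_ , _ , rest) (suc t) = trace rest t

  trace-chain : ∀ {m ν ν''} (P : Pow R m ν ν'') → Chain (trace P) 0 m
  trace-chain {suc m} (_ , sat , rest) zero    _ _         = sat
  trace-chain {suc m} (_ , sat , rest) (suc t) _ (s≤s t<m) = trace-chain rest t z≤n t<m

  trace-end : ∀ {m ν ν''} (P : Pow R m ν ν'') → ∀ i → trace P m i ≡ ν'' i
  trace-end {zero}  P              i = P i
  trace-end {suc m} (_ , _ , rest) i = trace-end rest i

  delay : ∀ {G m} k → Chain G 0 m → Chain (λ q → G (q ∸ k)) k (k +ℕ m)
  delay {G} {m} k chain q k≤q q<k+m =
    subst (λ t → Sat R (G (q ∸ k)) (G t)) (sym (ℕP.+-∸-assoc 1 k≤q))
      (chain (q ∸ k) z≤n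
        (subst (q ∸ k <ℕ_) (ℕP.m+n∸m≡n k m) (ℕP.∸-monoˡ-< q<k+m k≤q)))

  InWindow : ℕ → ℕ → ℕ → Node N → Set
  InWindow a b s x = a ≤ℕ pos x +ℕ s × pos x +ℕ s ≤ℕ b

  -- At the top of a chain an atom on the unprimed copy holds, via its
  -- primed twin and the last step of the chain.
  top-atom : Balanced R → ∀ {G a b} → a <ℕ b → Chain G a b →
    ∀ {x y c} → atom (inj₁ x) (inj₁ y) c ∈ R → G b x - G b y ≤ c
  top-atom bal {b = suc b'} (s≤s a≤b') chain {x} {y} {c} mem =
    All.lookup (chain b' a≤b' ℕP.≤-refl) (proj₁ (bal x y c) mem)

  -- At the bottom an atom on the primed copy holds, via its unprimed twin
  -- and the first step of the chain.
  bottom-atom : Balanced R → ∀ {G a b} → a <ℕ b → Chain G a b →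
    ∀ {x y c} → atom (inj₂ x) (inj₂ y) c ∈ R → G a x - G a y ≤ c
  bottom-atom bal {a = a} a<b chain {x} {y} {c} mem =
    All.lookup (chain a ℕP.≤-refl a<b) (proj₂ (bal x y c) mem)

  module Window (bal : Balanced R) {G : ℕ → Val N} {a b : ℕ} (a<b : a <ℕ b)
                (chain : Chain G a b) (s : ℕ) where

    potential : Node N → ℤ
    potential x = G (pos x +ℕ s) (proj₂ x)

    window-edge : ∀ {n u v c} → Edge R n u v c →
      InWindow a b s u → InWindow a b s v → potential u - potential v ≤ c
    window-edge (p , atom (inj₁ x) (inj₁ y) c , _ , mem , refl , refl , refl) (a≤ , ≤b) _
      with ℕP.m≤n⇒m<n∨m≡n ≤b
    ... | inj₁ <b  = All.lookup (chain (p +ℕ s) a≤ <b) mem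
    ... | inj₂ ≡b  = subst (λ q → G q x - G q y ≤ c) (sym ≡b) (top-atom bal a<b chain mem)
    window-edge (p , atom (inj₂ x) (inj₂ y) c , _ , mem , refl , refl , refl) (a≤ , ≤b) _
      with a ≤? p +ℕ s
    ... | yes a≤′ = All.lookup (chain (p +ℕ s) a≤′ ≤b) mem
    ... | no  a≰′ = subst (λ q → G q x - G q y ≤ c)
                      (ℕP.≤-antisym a≤ (ℕP.≰⇒> a≰′)) (bottom-atom bal a<b chain mem)
    window-edge (p , atom (inj₁ x) (inj₂ y) c , _ , mem , refl , refl , refl) (a≤ , _) (_ , ≤b) =
      All.lookup (chain (p +ℕ s) a≤ ≤b) mem
    window-edge (p , atom (inj₂ x) (inj₁ y) c , _ , mem , refl , refl , refl) (_ , ≤b) (a≤ , _) =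
      All.lookup (chain (p +ℕ s) a≤ ≤b) mem

  window-bound : Balanced R → ∀ {m ν ν''} (P : Pow R m ν ν'') → 0 <ℕ m →
    ∀ {n k i j} (θ : Path R n (k , i) (k , j)) s →
    All (InWindow k (k +ℕ m) s) (nodes θ) →
    trace P s i - trace P s j ≤ weight θ
  window-bound bal {m} P m>0 {k = k} {i} {j} θ s inside =
    subst (λ t → trace P t i - trace P t j ≤ weight θ) (ℕP.m+n∸m≡n k s)
      (path-potential potential (InWindow k (k +ℕ m) s) window-edge θ inside)
    where
    open Window bal (ℕP.m<m+n k m>0) (delay k (trace-chain P)) s

-- The window needs at least one step (N² ≥ 1); a variable index provides N ≥ 1.
square-pos : (N : ℕ) → Fin N → 0 <ℕ N ^ 2
square-pos (suc N) _ = s≤s z≤n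

forward-bound : ∀ {N} (R : DB N) → Balanced R → ∀ {n k i j}
  (θ : Path R n (k , i) (k , j)) → All (InWindow R k (k +ℕ N ^ 2) 0) (nodes θ) →
  ∀ ν → Sfw R ν → ν i - ν j ≤ weight θ
forward-bound {N} R bal {i = i} θ inside ν (_ , P) =
  window-bound R bal P (square-pos N i) θ 0 inside

backward-bound : ∀ {N} (R : DB N) → Balanced R → ∀ {n k i j}
  (θ : Path R n (k , i) (k , j)) → All (InWindow R k (k +ℕ N ^ 2) (N ^ 2)) (nodes θ) →
  ∀ ν' → Sbw R ν' → ν' i - ν' j ≤ weight θ
backward-bound {N} R bal {i = i} {j} θ inside ν' (_ , P) =
  subst₂ (λ u v → u - v ≤ weight θ) (trace-end R P i) (trace-end R P j)
    (window-bound R bal P (square-pos N i) θ (N ^ 2) inside)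

module _ {N : ℕ} {R : DB N} {n k : ℕ} {i j : Fin N} {θ : Path R n (k , i) (k , j)}
         {d M : ℕ} (d≤M : d ≤ℕ M) where

  right-window : RightCorner k θ d → All (InWindow R k (k +ℕ M) 0) (nodes θ)
  right-window (_ , within , _) = All.map (λ {x} → in-window {x}) within
    where
    in-window : ∀ {x} → k ≤ℕ pos x × pos x ≤ℕ k +ℕ d → InWindow R k (k +ℕ M) 0 x
    in-window {x} (k≤ , ≤k+d) rewrite ℕP.+-identityʳ (pos x) =
      k≤ , ℕP.≤-trans ≤k+d (ℕP.+-monoʳ-≤ k d≤M)

  left-window : LeftCorner k θ d → All (InWindow R k (k +ℕ M) M) (nodes θ)
  left-window (_ , _ , within , _) = All.map (λ {x} → in-window {x}) within
    where
    in-window : ∀ {x} → k ≤ℕ pos x +ℕ d × pos x ≤ℕ k → InWindow R k (k +ℕ M) M x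
    in-window {x} (k≤ , ≤k) =
      ℕP.≤-trans k≤ (ℕP.+-monoʳ-≤ (pos x) d≤M) , ℕP.+-monoˡ-≤ M ≤k

module _ {N : ℕ} {R : DB N} {n k : ℕ} {i j : Fin N} {θ : Path R n (k , i) (k , j)} where

  flat-window : ∀ {s M} → s ≤ℕ M → All (λ x → pos x ≡ k) (nodes θ) →
    All (InWindow R k (k +ℕ M) s) (nodes θ)
  flat-window {s} s≤M = All.map λ { refl → ℕP.m≤m+n k s , ℕP.+-monoʳ-≤ k s≤M }

  right-corner-at-end : ∀ {d} → RightCorner k θ d → k ≡ n → All (λ x → pos x ≡ k) (nodes θ)
  right-corner-at-end (nonempty , within , _) refl =
    All.zipWith (λ { ((k≤ , _) , ≤n) → ℕP.≤-antisym ≤n k≤ })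
      (within , path-pos θ nonempty)

  left-corner-at-start : ∀ {d} → LeftCorner k θ d → k ≡ 0 → All (λ x → pos x ≡ k) (nodes θ)
  left-corner-at-start (_ , _ , within , _) refl =
    All.map (λ { (_ , ≤0) → ℕP.n≤0⇒n≡0 ≤0 }) within

  corner-start : 1 ≤ℕ edges θ → k ≤ℕ n
  corner-start nonempty = source-of-nodes θ (path-pos θ nonempty)

module _ {N : ℕ} {R : DB N} {n : ℕ} {i j : Fin N} {w : ℤ} (Tfw Tbw : DB N) where

  forward-edge : ∀ {k} → DBRep Unprimed (Sfw R) Tfw → k <ℕ n →
    (∀ ν → Sfw R ν → ν i - ν j ≤ w) →
    ∃[ c ] (c ≤ w × Edge (R ++ (Tfw ++ Tbw)) n (k , i) (k , j) c)
  forward-edge {k} rep k<n implied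
    with DBRep.closed rep i j w (λ ν ν' sat → implied _ (DBRep.sound rep ν ν' sat))
  ... | c' , c'≤w , mem =
    c' , c'≤w , k , atom (inj₁ i) (inj₁ j) c' , k<n , ∈-++⁺ʳ R (∈-++⁺ˡ mem) , refl , refl , refl

  backward-edge : ∀ {k} → DBRep Primed (Sbw R) Tbw → 0 <ℕ k → k ≤ℕ n →
    (∀ ν' → Sbw R ν' → ν' i - ν' j ≤ w) →
    ∃[ c ] (c ≤ w × Edge (R ++ (Tfw ++ Tbw)) n (k , i) (k , j) c)
  backward-edge {suc p} rep _ p<n implied
    with DBRep.closed rep i j w (λ ν ν' sat → implied _ (DBRep.sound rep ν ν' sat))
  ... | c' , c'≤w , mem =
    c' , c'≤w , p , atom (inj₂ i) (inj₂ j) c' , p<n , ∈-++⁺ʳ R (∈-++⁺ʳ Tfw mem) , refl , refl , refl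

corner-vertical-edge : ∀ {N} (R : DB N) → Balanced R → ∀ {n} → 1 ≤ℕ n →
  ∀ {k i j} (θ : Path R n (k , i) (k , j)) {d} → d ≤ℕ N ^ 2 →
  RightCorner k θ d ⊎ LeftCorner k θ d →
  ∀ (Tfw Tbw : DB N) → DBRep Unprimed (Sfw R) Tfw → DBRep Primed (Sbw R) Tbw →
  ∃[ c ] (c ≤ weight θ × Edge (R ++ (Tfw ++ Tbw)) n (k , i) (k , j) c)
corner-vertical-edge {N} R bal {n} n≥1 {k} θ d≤M (inj₁ rc) Tfw Tbw fw bw with k <? n
... | yes k<n = forward-edge Tfw Tbw fw k<n (forward-bound R bal θ (right-window d≤M rc))
... | no  k≮n = backward-edge Tfw Tbw bw (subst (0 <ℕ_) (sym k≡n) n≥1) (ℕP.≤-reflexive k≡n)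
                  (backward-bound R bal θ (flat-window ℕP.≤-refl (right-corner-at-end rc k≡n)))
  where
  k≡n : k ≡ n
  k≡n = ℕP.≤-antisym (corner-start (proj₁ rc)) (ℕP.≮⇒≥ k≮n)
corner-vertical-edge {N} R bal {n} n≥1 {k} θ d≤M (inj₂ lc) Tfw Tbw fw bw with k ≟ 0
... | yes k≡0 = forward-edge Tfw Tbw fw (subst (_<ℕ n) (sym k≡0) n≥1)
                  (forward-bound R bal θ (flat-window z≤n (left-corner-at-start lc k≡0)))
... | no  k≢0 = backward-edge Tfw Tbw bw (ℕP.n≢0⇒n>0 k≢0) (corner-start (proj₁ lc))
                  (backward-bound R bal θ (left-window d≤M lc))

proposition5 : (N : ℕ) (R : DB N) → Balanced R →
    (n : ℕ) → 1 ≤ℕ n →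
    (k : ℕ) (i j : Fin N) (θ : Path R n (k , i) (k , j)) (d : ℕ) → d ≤ℕ N ^ 2 →
    ((RightCorner k θ d →
        (∀ ν ν' → Rs R ν ν' → Sfw R ν) ×
        (∀ ν → Sfw R ν → ν i - ν j ≤ weight θ)) ×
     (LeftCorner k θ d →
        (∀ ν ν' → Rs R ν ν' → Sbw R ν') ×
        (∀ ν' → Sbw R ν' → ν' i - ν' j ≤ weight θ))) ×
    (RightCorner k θ d ⊎ LeftCorner k θ d →
      ∀ (Tfw Tbw : DB N) → DBRep Unprimed (Sfw R) Tfw → DBRep Primed (Sbw R) Tbw →
      ∃[ c ] (c ≤ weight θ × Edge (R ++ (Tfw ++ Tbw)) n (k , i) (k , j) c))
proposition5 N R bal n n≥1 k i j θ d d≤M =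
  ( (λ rc → (λ _ _ rs → proj₁ (proj₂ rs)) , forward-bound R bal θ (right-window d≤M rc))
  , (λ lc → (λ _ _ rs → proj₂ (proj₂ rs)) , backward-bound R bal θ (left-window d≤M lc)) )
  , corner-vertical-edge R bal n≥1 θ d≤M
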